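{- Let $D$ be a diagram and $c$ a nonempty column of $D$. Then \[h(D,c)=\max\{r : (r,c)\in\tilde D \text{ for some } \tilde D\in\mathrm{Min}(D)\}.\]
   Context: A diagram is a finite subset $D\subset\mathbb{Z}_{>0}\times\mathbb{Z}_{>0}$; $(r,c)\in D$ is a cell in row $r$, column $c$. Kohnert move at row $r$: if row $r$ is empty, $\mathcal{K}(D,r)=D$; otherwise let $(r,c)$ be the rightmost cell of row $r$; if some $r'<r$ has $(r',c)\notin D$, take the largest such $r'$ and set $\mathcal{K}(D,r)=(D\setminus\{(r,c)\})\cup\{(r',c)\}$; else $\mathcal{K}(D,r)=D$. $\mathrm{KD}(D)$ is the set of diagrams obtainable from $D$ by finite sequences of Kohnert moves, and $\mathrm{Min}(D)=\{\tilde D\in\mathrm{KD}(D):\mathcal{K}(\tilde D,r)=\tilde D\ \forall r\}$. For a nonempty column $c$ of $D$: let $m_c$ be the number of cells in column $c$, $M$ the maximum number of cells in a column of $D$ strictly to the right of $c$ ($M=0$ if none), and $r$ the row of the topmost cell of column $c$ in $D$; define $h(D,c)=r$ if $M\ge r$, $h(D,c)=m_c$ if $m_c\ge M$, and $h(D,c)=M$ if $r>M>m_c$. -}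

module Defs where

open import Data.Nat using (ℕ; zero; suc; _≤_; _<_; _⊔_; _≟_; _≤?_)
open import Data.Bool using (Bool; true; false; if_then_else_)
open import Data.List using (List; map; foldr; upTo; filter; length; drop)
open import Data.Product using (Σ; ∃; ∃-syntax; _×_; _,_)
open import Data.Sum using (_⊎_)
open import Relation.Nullary.Decidable using (⌊_⌋)
open import Relation.Binary.PropositionalEquality using (_≡_)
open import Relation.Binary.Construct.Closure.ReflexiveTransitive using (Star)

record Diagram : Set where
  field
    bound  : ℕ
    cell   : ℕ → ℕ → Bool
    finite : ∀ r c → cell r c ≡ true → (r ≤ bound) × (c ≤ bound)
    row0   : ∀ c → cell 0 c ≡ false
    col0   : ∀ r → cell r 0 ≡ false
open Diagram public

_∋_,_ : Diagram → ℕ → ℕ → Set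
D ∋ r , c = cell D r c ≡ true

_≈D_ : Diagram → Diagram → Set
D ≈D E = ∀ r c → cell D r c ≡ cell E r c

moveCell : Diagram → ℕ → ℕ → ℕ → (ℕ → ℕ → Bool)
moveCell D r r' c x y =
  if ⌊ y ≟ c ⌋
  then (if ⌊ x ≟ r ⌋ then false else (if ⌊ x ≟ r' ⌋ then true else cell D x y))
  else cell D x y

RowEmpty : Diagram → ℕ → Set
RowEmpty D r = ∀ c → cell D r c ≡ false

Rightmost : Diagram → ℕ → ℕ → Set
Rightmost D r c = (D ∋ r , c) × (∀ c' → c < c' → cell D r c' ≡ false)

-- KMove D r E  :  E = 𝒦(D , r)   (as sets of cells)
data KMove (D : Diagram) (r : ℕ) (E : Diagram) : Set where
  empty-row : RowEmpty D r → D ≈D E → KMove D r E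
  move      : ∀ c r' → Rightmost D r c
            → 1 ≤ r' → r' < r → cell D r' c ≡ false
            → (∀ r'' → r' < r'' → r'' < r → D ∋ r'' , c)
            → (∀ x y → cell E x y ≡ moveCell D r r' c x y)
            → KMove D r E
  stuck     : ∀ c → Rightmost D r c
            → (∀ r' → 1 ≤ r' → r' < r → D ∋ r' , c)
            → D ≈D E → KMove D r E

KStep : Diagram → Diagram → Set
KStep D E = ∃[ r ] KMove D r E

KD : Diagram → Diagram → Set
KD D E = Star KStep D E

Min : Diagram → Diagram → Set
Min D E = KD D E × (∀ r → KMove E r E)

maximum : List ℕ → ℕ
maximum = foldr _⊔_ 0

rows : Diagram → List ℕ
rows D = upTo (suc (bound D))

colSize : Diagram → ℕ → ℕ
colSize D c = length (filter (λ r → cell D r c ≡? true) (rows D))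
  where
  open import Data.Bool.Properties using () renaming (_≟_ to _≡?_)

maxRight : Diagram → ℕ → ℕ
maxRight D c = maximum (map (colSize D) (drop (suc c) (upTo (suc (bound D)))))

-- row of the topmost cell of column c (largest row index; 0 if empty)
topRow : Diagram → ℕ → ℕ
topRow D c = maximum (map (λ r → if cell D r c then r else 0) (rows D))

-- h(D , c) : r if M ≥ r ; m_c if m_c ≥ M ; M if r > M > m_c
-- (the first two cases overlap only when they agree: then m_c = M = r)
h : Diagram → ℕ → ℕ
h D c =
  if ⌊ topRow D c ≤? maxRight D c ⌋ then topRow D c
  else (if ⌊ maxRight D c ≤? colSize D c ⌋ then colSize D c else maxRight D c)

{-# OPTIONS --safe #-}
-- A Kohnert move drops one cell to a lower row of its column, so column sizes are invariant and
-- no cell ends above where it started; a diagram is minimal exactly when every row is stuck, i.e.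
-- the column of its rightmost cell is filled from row 1 up to that row.  So a cell (ρ, c) of a
-- minimal diagram tops a full column c0 ≥ c of height ρ, whence ρ ≤ r and ρ ≤ m_c or ρ ≤ M,
-- that is ρ ≤ h(D, c).  Conversely, if h = m_c the m_c cells of column c force one into a row
-- ≥ m_c in any minimal diagram.  Otherwise T = h is at most both r and M: settling first the
-- rows whose rightmost cell lies right of c leaves column c alone and yields a column c1 > c
-- filled up to row T; those rows stay stuck, and column c keeps a cell in some row ≥ T while the
-- rest of the diagram is settled.  Termination is by the sum of the row indices of all cells.
module Submission where

open import Defs
open import Data.Nat using (ℕ; _≤_)
open import Data.Product using (Σ; ∃; ∃-syntax; _×_; _,_)

open import Data.Nat using (zero; suc; _+_; _∸_; _<_; _⊔_; _≟_; _≤?_; _<?_; z≤n; s≤s; s≤s⁻¹)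
open import Data.Nat.Properties
open import Data.Nat.Induction using (<-wellFounded)
open import Data.Bool using (Bool; true; false; if_then_else_)
open import Data.Bool.Properties using (¬-not; not-¬) renaming (_≟_ to _≡?_)
open import Data.List using ([]; _∷_; [_]; _++_; map; filter; length; drop; upTo; applyUpTo)
open import Data.List.Properties using (applyUpTo-∷ʳ; filter-++; length-++)
open import Data.List.Membership.Propositional using (_∈_)
open import Data.List.Membership.Propositional.Properties using (∈-map⁺; ∈-map⁻; ∈-applyUpTo⁺; ∈-applyUpTo⁻; ∈-upTo⁺)
open import Data.List.Relation.Unary.Any using (here; there)
open import Data.Product using (proj₁; proj₂)
open import Data.Sum using (_⊎_; inj₁; inj₂; [_,_]′)
open import Data.Unit using (⊤; tt)
open import Function using (id; _∘_)
open import Induction.WellFounded using (Acc; acc)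
open import Relation.Binary.Definitions using (tri<; tri≈; tri>)
open import Relation.Binary.PropositionalEquality using (_≡_; _≢_; refl; sym; trans; cong; cong₂; subst; ≢-sym; module ≡-Reasoning)
open import Relation.Binary.Construct.Closure.ReflexiveTransitive using (ε; _◅_; _◅◅_)
open import Relation.Nullary using (¬_; yes; no; contradiction)
open import Relation.Nullary.Decidable using (⌊_⌋)
import Relation.Unary as U
open import Algebra.Properties.CommutativeSemigroup +-commutativeSemigroup using (xy∙z≈xz∙y)

sumBelow : (ℕ → ℕ) → ℕ → ℕ
sumBelow F zero    = 0
sumBelow F (suc n) = sumBelow F n + F n

sumBelow-cong : ∀ {F G} n → (∀ i → i < n → F i ≡ G i) → sumBelow F n ≡ sumBelow G n
sumBelow-cong zero    F≡G = refl
sumBelow-cong (suc n) F≡G =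
  cong₂ _+_ (sumBelow-cong n (λ i i<n → F≡G i (m<n⇒m<1+n i<n))) (F≡G n ≤-refl)

term≤sumBelow : ∀ F {i n} → i < n → F i ≤ sumBelow F n
term≤sumBelow F {i} {suc n} i<1+n with m≤n⇒m<n∨m≡n (s≤s⁻¹ i<1+n)
... | inj₂ refl = m≤n+m (F i) _
... | inj₁ i<n  = ≤-trans (term≤sumBelow F i<n) (m≤m+n _ (F n))

sumBelow-mono : ∀ F {m n} → m ≤ n → sumBelow F m ≤ sumBelow F n
sumBelow-mono F {n = zero}  z≤n = ≤-refl
sumBelow-mono F {n = suc n} m≤1+n with m≤n⇒m<n∨m≡n m≤1+n
... | inj₂ refl  = ≤-refl
... | inj₁ m<1+n = ≤-trans (sumBelow-mono F (s≤s⁻¹ m<1+n)) (m≤m+n _ (F n))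

sumBelow-vanishing : ∀ F {m n} → m ≤ n → (∀ i → m ≤ i → F i ≡ 0) → sumBelow F n ≡ sumBelow F m
sumBelow-vanishing F {n = zero}  z≤n F≡0 = refl
sumBelow-vanishing F {m} {suc n} m≤1+n F≡0 with m≤n⇒m<n∨m≡n m≤1+n
... | inj₂ refl  = refl
... | inj₁ m<1+n = begin
  sumBelow F n + F n ≡⟨ cong (sumBelow F n +_) (F≡0 n (s≤s⁻¹ m<1+n)) ⟩
  sumBelow F n + 0   ≡⟨ +-identityʳ _ ⟩
  sumBelow F n       ≡⟨ sumBelow-vanishing F (s≤s⁻¹ m<1+n) F≡0 ⟩
  sumBelow F m       ∎
  where open ≡-Reasoning

sumBelow-update : ∀ {F G a} n → a < n → (∀ i → i ≢ a → G i ≡ F i) →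
                  sumBelow G n + F a ≡ sumBelow F n + G a
sumBelow-update {F} {G} {a} (suc n) a<1+n G≡F with a ≟ n
... | yes refl = trans (cong (λ s → s + G a + F a) (sumBelow-cong a (λ i i<a → G≡F i (<⇒≢ i<a))))
                       (xy∙z≈xz∙y _ (G a) (F a))
... | no a≢n = begin
  sumBelow G n + G n + F a ≡⟨ xy∙z≈xz∙y _ (G n) (F a) ⟩
  sumBelow G n + F a + G n ≡⟨ cong₂ _+_ (sumBelow-update n (≤∧≢⇒< (s≤s⁻¹ a<1+n) a≢n) G≡F)
                                        (G≡F n (≢-sym a≢n)) ⟩
  sumBelow F n + G a + F n ≡⟨ xy∙z≈xz∙y _ (G a) (F n) ⟩
  sumBelow F n + F n + G a ∎
  where open ≡-Reasoning

sumWhere : (ℕ → Bool) → (ℕ → ℕ) → ℕ → ℕ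
sumWhere f v = sumBelow (λ i → if f i then v i else 0)

count : (ℕ → Bool) → ℕ → ℕ
count f = sumWhere f (λ _ → 1)

set : (ℕ → Bool) → ℕ → Bool → ℕ → Bool
set f a b x = if ⌊ x ≟ a ⌋ then b else f x

set-≡ : ∀ f a b → set f a b a ≡ b
set-≡ f a b with a ≟ a
... | yes _   = refl
... | no a≢a = contradiction refl a≢a

set-≢ : ∀ f {a} b {x} → x ≢ a → set f a b x ≡ f x
set-≢ f {a} b {x} x≢a with x ≟ a
... | yes x≡a = contradiction x≡a x≢a
... | no _    = refl

set-true : ∀ f a {x} → f x ≡ true → set f a true x ≡ true
set-true f a {x} fx with x ≟ a
... | yes _ = refl
... | no _  = fx

sumWhere-set : ∀ f v {a b₀ n} b → f a ≡ b₀ → a < n →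
               sumWhere (set f a b) v n + (if b₀ then v a else 0) ≡ sumWhere f v n + (if b then v a else 0)
sumWhere-set f v {a} {n = n} b refl a<n =
  trans (sumBelow-update n a<n (λ i i≢a → cong (λ b → if b then v i else 0) (set-≢ f b i≢a)))
        (cong (λ b → sumWhere f v n + (if b then v a else 0)) (set-≡ f a b))

sumWhere-move : ∀ f v {ρ r' n} → f ρ ≡ true → f r' ≡ false → r' < ρ → ρ < n →
                sumWhere (set (set f r' true) ρ false) v n + v ρ ≡ sumWhere f v n + v r'
sumWhere-move f v {ρ} {r'} fρ fr' r'<ρ ρ<n =
  trans (sumWhere-set (set f r' true) v false (trans (set-≢ f true (>⇒≢ r'<ρ)) fρ) ρ<n)
        (sumWhere-set f v true fr' (<-trans r'<ρ ρ<n))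

count-≤ : ∀ f n → f 0 ≡ false → count f (suc n) ≤ n
count-≤ f zero    f0 rewrite f0 = z≤n
count-≤ f (suc n) f0 = subst (count f (suc (suc n)) ≤_) (+-comm n 1)
                             (+-mono-≤ (count-≤ f n f0) (indicator≤1 (f (suc n))))
  where
  indicator≤1 : ∀ b → (if b then 1 else 0) ≤ 1
  indicator≤1 true  = ≤-refl
  indicator≤1 false = z≤n

count-witness : ∀ f n {m} → f 0 ≡ false → 1 ≤ m → m ≤ count f n → ∃[ t ] (m ≤ t × f t ≡ true)
count-witness f zero    f0 1≤m m≤0 = contradiction (≤-trans 1≤m m≤0) λ ()
count-witness f (suc n) {m} f0 1≤m m≤count with f n in fn
... | false = count-witness f n f0 1≤m (subst (m ≤_) (+-identityʳ _) m≤count)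
... | true with m ≤? n
...   | yes m≤n = n , m≤n , fn
...   | no m≰n  = contradiction (≤-trans m≤count count≤n) (<⇒≱ (≰⇒> m≰n))
  where
  count≤n : count f n + 1 ≤ n
  count≤n = subst (λ b → count f n + (if b then 1 else 0) ≤ n) fn (count-≤ f n f0)

count-full : ∀ f ρ → (∀ i → 1 ≤ i → i ≤ ρ → f i ≡ true) → ρ ≤ count f (suc ρ)
count-full f zero    full = z≤n
count-full f (suc ρ) full rewrite full (suc ρ) (s≤s z≤n) ≤-refl =
  subst (_≤ count f (suc ρ) + 1) (+-comm ρ 1)
        (+-monoˡ-≤ 1 (count-full f ρ (λ i 1≤i i≤ρ → full i 1≤i (m≤n⇒m≤1+n i≤ρ))))

length-filter-upTo : ∀ f n → length (filter (λ r → f r ≡? true) (upTo n)) ≡ count f n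
length-filter-upTo f zero    = refl
length-filter-upTo f (suc n) = begin
  length (filter P? (upTo (suc n)))           ≡⟨ cong (length ∘ filter P?) (sym (applyUpTo-∷ʳ id n)) ⟩
  length (filter P? (upTo n ++ [ n ]))        ≡⟨ cong length (filter-++ P? (upTo n) [ n ]) ⟩
  length (filter P? (upTo n) ++ filter P? [ n ]) ≡⟨ length-++ (filter P? (upTo n)) ⟩
  length (filter P? (upTo n)) + length (filter P? [ n ]) ≡⟨ cong₂ _+_ (length-filter-upTo f n) indicator ⟩
  count f (suc n) ∎
  where
  open ≡-Reasoning
  P? = λ r → f r ≡? true
  indicator : length (filter P? [ n ]) ≡ (if f n then 1 else 0)
  indicator with f n
  ... | true  = refl
  ... | false = refl

maximum-upper : ∀ {x xs} → x ∈ xs → x ≤ maximum xs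
maximum-upper (here refl)          = m≤m⊔n _ _
maximum-upper {xs = y ∷ _} (there x∈xs) = ≤-trans (maximum-upper x∈xs) (m≤n⊔m y _)

maximum-∈ : ∀ xs → maximum xs ≡ 0 ⊎ maximum xs ∈ xs
maximum-∈ []       = inj₁ refl
maximum-∈ (x ∷ xs) with ⊔-sel x (maximum xs)
... | inj₁ max≡x = inj₂ (here max≡x)
... | inj₂ max≡max with maximum-∈ xs
...   | inj₁ max≡0  = inj₁ (trans max≡max max≡0)
...   | inj₂ max∈xs = inj₂ (there (subst (_∈ xs) (sym max≡max) max∈xs))

drop-applyUpTo : ∀ {A : Set} k (f : ℕ → A) n →
                 drop k (applyUpTo f n) ≡ applyUpTo (λ i → f (k + i)) (n ∸ k)
drop-applyUpTo zero    f n       = refl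
drop-applyUpTo (suc k) f zero    = refl
drop-applyUpTo (suc k) f (suc n) = drop-applyUpTo k (f ∘ suc) n

∈-drop-upTo⁺ : ∀ {k i n} → k ≤ i → i < n → i ∈ drop k (upTo n)
∈-drop-upTo⁺ {k} {i} {n} k≤i i<n rewrite drop-applyUpTo k id n =
  subst (_∈ _) (m+[n∸m]≡n k≤i) (∈-applyUpTo⁺ (k +_) (∸-monoˡ-< i<n k≤i))

∈-drop-upTo⁻ : ∀ {k i n} → i ∈ drop k (upTo n) → k ≤ i
∈-drop-upTo⁻ {k} {i} {n} i∈ rewrite drop-applyUpTo k id n with ∈-applyUpTo⁻ (k +_) i∈
... | j , _ , refl = m≤m+n k j

lastBelow : ∀ {P : ℕ → Set} → U.Decidable P → ∀ n →
            (∃[ i ] (i < n × P i × (∀ j → i < j → j < n → ¬ P j))) ⊎ (∀ j → j < n → ¬ P j)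
lastBelow P? zero = inj₂ (λ j ())
lastBelow P? (suc n) with P? n | lastBelow P? n
... | yes Pn  | _    = inj₁ (n , ≤-refl , Pn , λ j n<j j<1+n → contradiction (s≤s⁻¹ j<1+n) (<⇒≱ n<j))
... | no ¬Pn | inj₁ (i , i<n , Pi , last) = inj₁ (i , m<n⇒m<1+n i<n , Pi ,
  λ j i<j j<1+n → [ last j i<j , (λ { refl → ¬Pn }) ]′ (m<1+n⇒m<n∨m≡n j<1+n))
... | no ¬Pn | inj₂ none = inj₂ (λ j j<1+n → [ none j , (λ { refl → ¬Pn }) ]′ (m<1+n⇒m<n∨m≡n j<1+n))

allBelow-or : ∀ {P : ℕ → Set} {Q : Set} → (∀ i → P i ⊎ Q) → ∀ n → (∀ i → i < n → P i) ⊎ Q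
allBelow-or P⊎Q zero = inj₁ (λ i ())
allBelow-or P⊎Q (suc n) with allBelow-or P⊎Q n | P⊎Q n
... | inj₂ q     | _      = inj₂ q
... | inj₁ _     | inj₂ q = inj₂ q
... | inj₁ below | inj₁ Pn = inj₁ λ i i<1+n → [ below i , (λ { refl → Pn }) ]′ (m<1+n⇒m<n∨m≡n i<1+n)

column : Diagram → ℕ → ℕ → Bool
column E c r = cell E r c

∋-row-pos : ∀ E {r c} → E ∋ r , c → 1 ≤ r
∋-row-pos E {zero}  {c} e = contradiction e (not-¬ (row0 E c))
∋-row-pos E {suc r}     e = s≤s z≤n

∋-col-pos : ∀ E {r c} → E ∋ r , c → 1 ≤ c
∋-col-pos E {r} {zero} e = contradiction e (not-¬ (col0 E r))
∋-col-pos E {c = suc c} e = s≤s z≤n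

∋-row-bound : ∀ E {r c} → E ∋ r , c → r ≤ bound E
∋-row-bound E e = proj₁ (finite E _ _ e)

∋-col-bound : ∀ E {r c} → E ∋ r , c → c ≤ bound E
∋-col-bound E e = proj₂ (finite E _ _ e)

FilledBelow : Diagram → ℕ → ℕ → Set
FilledBelow E c ρ = ∀ r → 1 ≤ r → r < ρ → E ∋ r , c

FilledBelow-mono : ∀ {E c m n} → m ≤ n → FilledBelow E c n → FilledBelow E c m
FilledBelow-mono m≤n filled r 1≤r r<m = filled r 1≤r (<-≤-trans r<m m≤n)

FilledBelow-extend : ∀ {E c ρ} → FilledBelow E c ρ → E ∋ ρ , c → FilledBelow E c (suc ρ)
FilledBelow-extend filled e r 1≤r r<1+ρ = [ filled r 1≤r , (λ { refl → e }) ]′ (m<1+n⇒m<n∨m≡n r<1+ρ)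

rightmost? : ∀ E ρ → RowEmpty E ρ ⊎ ∃ (Rightmost E ρ)
rightmost? E ρ with lastBelow (λ c → cell E ρ c ≡? true) (suc (bound E))
... | inj₁ (c , _ , e , last) =
  inj₂ (c , e , λ c' c<c' → ¬-not (λ e' → last c' c<c' (s≤s (∋-col-bound E e')) e'))
... | inj₂ none = inj₁ (λ c → ¬-not (λ e → none c (s≤s (∋-col-bound E e)) e))

rightmost-≥ : ∀ {E ρ c0 c} → Rightmost E ρ c0 → E ∋ ρ , c → c ≤ c0
rightmost-≥ {c0 = c0} {c} (_ , right) e with c ≤? c0
... | yes c≤c0 = c≤c0
... | no c≰c0  = contradiction e (not-¬ (right c (≰⇒> c≰c0)))

rightmost-unique : ∀ {E ρ a b} → Rightmost E ρ a → Rightmost E ρ b → a ≡ b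
rightmost-unique {E} {ρ} ra rb =
  ≤-antisym (rightmost-≥ {E} {ρ} rb (proj₁ ra)) (rightmost-≥ {E} {ρ} ra (proj₁ rb))

moveCell-elsewhere : ∀ E ρ r' c0 {x y} → y ≢ c0 → moveCell E ρ r' c0 x y ≡ cell E x y
moveCell-elsewhere E ρ r' c0 {x} {y} y≢c0 with y ≟ c0
... | yes y≡c0 = contradiction y≡c0 y≢c0
... | no _     = refl

moveCell-column : ∀ E ρ r' c0 x → moveCell E ρ r' c0 x c0 ≡ set (set (column E c0) r' true) ρ false x
moveCell-column E ρ r' c0 x with c0 ≟ c0
... | yes _      = refl
... | no c0≢c0 = contradiction refl c0≢c0

moveCell-source : ∀ E ρ r' c0 {x y} → moveCell E ρ r' c0 x y ≡ true → (y ≡ c0 × x ≡ r') ⊎ E ∋ x , y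
moveCell-source E ρ r' c0 {x} {y} m with y ≟ c0
... | no _ = inj₂ m
... | yes y≡c0 with x ≟ ρ | x ≟ r'
...   | yes _ | _        = contradiction m λ ()
...   | no _  | yes x≡r' = inj₁ (y≡c0 , x≡r')
...   | no _  | no _     = inj₂ m

moved : ∀ E ρ r' c0 → E ∋ ρ , c0 → 1 ≤ r' → r' < ρ → Diagram
moved E ρ r' c0 e 1≤r' r'<ρ = record
  { bound  = bound E
  ; cell   = moveCell E ρ r' c0
  ; finite = λ x y m → [ (λ { (refl , refl) → ≤-trans (<⇒≤ r'<ρ) (∋-row-bound E e) , ∋-col-bound E e })
                       , finite E x y ]′ (moveCell-source E ρ r' c0 m)
  ; row0   = λ y → ¬-not λ m → [ (λ { (_ , 0≡r') → <⇒≢ 1≤r' 0≡r' }) , not-¬ (row0 E y) ]′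
                                 (moveCell-source E ρ r' c0 m)
  ; col0   = λ x → ¬-not λ m → [ (λ { (0≡c0 , _) → <⇒≢ (∋-col-pos E e) 0≡c0 }) , not-¬ (col0 E x) ]′
                                 (moveCell-source E ρ r' c0 m)
  }

totalHeight : Diagram → ℕ
totalHeight E = sumBelow (λ c → sumWhere (column E c) id (suc (bound E))) (suc (bound E))

totalHeight-moved : ∀ E ρ r' c0 (e : E ∋ ρ , c0) (1≤r' : 1 ≤ r') (r'<ρ : r' < ρ) →
                    cell E r' c0 ≡ false → totalHeight (moved E ρ r' c0 e 1≤r' r'<ρ) < totalHeight E
totalHeight-moved E ρ r' c0 e 1≤r' r'<ρ free = +-cancelʳ-< (F c0) (sumBelow G n) (sumBelow F n) (begin-strict
  sumBelow G n + F c0 ≡⟨ other-columns ⟩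
  sumBelow F n + G c0 <⟨ +-monoʳ-< (sumBelow F n) column-c0 ⟩
  sumBelow F n + F c0 ∎)
  where
  open ≤-Reasoning
  n = suc (bound E)
  F G : ℕ → ℕ
  F c = sumWhere (column E c) id n
  G c = sumWhere (λ x → moveCell E ρ r' c0 x c) id n
  other-columns : sumBelow G n + F c0 ≡ sumBelow F n + G c0
  other-columns = sumBelow-update n (s≤s (∋-col-bound E e)) (λ c c≢c0 →
    sumBelow-cong n (λ x _ → cong (λ b → if b then x else 0) (moveCell-elsewhere E ρ r' c0 c≢c0)))
  column-c0 : G c0 < F c0
  column-c0 = +-cancelʳ-< ρ (G c0) (F c0) (begin-strict
    G c0 + ρ  ≡⟨ cong (_+ ρ) (sumBelow-cong n (λ x _ → cong (λ b → if b then x else 0)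
                                                        (moveCell-column E ρ r' c0 x))) ⟩
    sumWhere (set (set (column E c0) r' true) ρ false) id n + ρ
              ≡⟨ sumWhere-move (column E c0) id e free r'<ρ (s≤s (∋-row-bound E e)) ⟩
    F c0 + r' <⟨ +-monoʳ-< (F c0) r'<ρ ⟩
    F c0 + ρ  ∎)

kohnertStep? : ∀ E ρ → RowEmpty E ρ ⊎ ∃[ c0 ] (Rightmost E ρ c0 ×
               (FilledBelow E c0 ρ ⊎ ∃[ E' ] (KMove E ρ E' × totalHeight E' < totalHeight E)))
kohnertStep? E ρ with rightmost? E ρ
... | inj₁ empty = inj₁ empty
... | inj₂ (c0 , rm@(e , _)) with lastBelow (λ r → cell E r c0 ≡? false) ρ
...   | inj₂ none = contradiction (row0 E c0) (none 0 (∋-row-pos E e))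
...   | inj₁ (zero , _ , _ , above) = inj₂ (c0 , rm , inj₁ (λ r 1≤r r<ρ → ¬-not (above r 1≤r r<ρ)))
...   | inj₁ (suc i , i<ρ , free , above) = inj₂ (c0 , rm , inj₂
  ( moved E ρ (suc i) c0 e (s≤s z≤n) i<ρ
  , move c0 (suc i) rm (s≤s z≤n) i<ρ free (λ r i<r r<ρ → ¬-not (above r i<r r<ρ)) (λ _ _ → refl)
  , totalHeight-moved E ρ (suc i) c0 e (s≤s z≤n) i<ρ free))

RowStuckRightOf : ℕ → Diagram → ℕ → Set
RowStuckRightOf c E ρ = ∀ c0 → Rightmost E ρ c0 → c < c0 → FilledBelow E c0 ρ

StuckRightOf : ℕ → Diagram → Set
StuckRightOf c E = ∀ ρ → RowStuckRightOf c E ρ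

MoveRightOf : ℕ → Diagram → Set
MoveRightOf c E = ∃[ E' ] ∃[ ρ ] ∃[ c0 ]
  (Rightmost E ρ c0 × c < c0 × KMove E ρ E' × totalHeight E' < totalHeight E)

rowStuckRightOf? : ∀ c E ρ → RowStuckRightOf c E ρ ⊎ MoveRightOf c E
rowStuckRightOf? c E ρ with kohnertStep? E ρ
... | inj₁ empty = inj₁ (λ c0 (e , _) _ → contradiction e (not-¬ (empty c0)))
... | inj₂ (c0 , rm , inj₁ filled) =
  inj₁ (λ c1 rm1 _ → subst (λ c' → FilledBelow E c' ρ) (rightmost-unique {E} {ρ} rm rm1) filled)
... | inj₂ (c0 , rm , inj₂ (E' , step , lower)) with c <? c0
...   | yes c<c0 = inj₂ (E' , ρ , c0 , rm , c<c0 , step , lower)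
...   | no c≮c0  =
  inj₁ (λ c1 rm1 c<c1 → contradiction (subst (c <_) (rightmost-unique {E} {ρ} rm1 rm) c<c1) c≮c0)

stuckRightOf? : ∀ c E → StuckRightOf c E ⊎ MoveRightOf c E
stuckRightOf? c E with allBelow-or (rowStuckRightOf? c E) (suc (bound E))
... | inj₁ rows = inj₁ (λ ρ c0 rm@(e , _) → rows ρ (s≤s (∋-row-bound E e)) c0 rm)
... | inj₂ step = inj₂ step

PreservedRightOf : ℕ → (Diagram → Set) → Set
PreservedRightOf c P = ∀ {E E' ρ c0} → Rightmost E ρ c0 → c < c0 → KMove E ρ E' → P E → P E'

settleRightOf : ∀ c (P : Diagram → Set) → PreservedRightOf c P →
                ∀ E → P E → ∃[ E' ] (KD E E' × StuckRightOf c E' × P E')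
settleRightOf c P preserved E = go E (<-wellFounded (totalHeight E))
  where
  go : ∀ E → Acc _<_ (totalHeight E) → P E → ∃[ E' ] (KD E E' × StuckRightOf c E' × P E')
  go E (acc smaller) PE with stuckRightOf? c E
  ... | inj₁ settled = E , ε , settled , PE
  ... | inj₂ (E' , ρ , c0 , rm , c<c0 , step , lower) with go E' (smaller lower) (preserved rm c<c0 step PE)
  ...   | E″ , E'↝E″ , settled , PE″ = E″ , (ρ , step) ◅ E'↝E″ , settled , PE″

stuck⇒fixed : ∀ {E} → StuckRightOf 0 E → ∀ r → KMove E r E
stuck⇒fixed {E} settled r with rightmost? E r
... | inj₁ empty           = empty-row empty (λ _ _ → refl)
... | inj₂ (c0 , rm@(e , _)) = stuck c0 rm (settled r c0 rm (∋-col-pos E e)) (λ _ _ → refl)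

fixed⇒filled : ∀ {E ρ c} → (∀ r → KMove E r E) → E ∋ ρ , c →
               ∃[ c0 ] (Rightmost E ρ c0 × FilledBelow E c0 ρ)
fixed⇒filled {E} {ρ} {c} fixed e with fixed ρ
... | empty-row empty _ = contradiction e (not-¬ (empty c))
... | stuck c0 rm filled _ = c0 , rm , filled
... | move c0 r' (e0 , _) _ r'<ρ _ _ E≡moved = contradiction e0 (not-¬ (begin
  cell E ρ c0 ≡⟨ E≡moved ρ c0 ⟩
  moveCell E ρ r' c0 ρ c0 ≡⟨ moveCell-column E ρ r' c0 ρ ⟩
  set (set (column E c0) r' true) ρ false ρ ≡⟨ set-≡ (set (column E c0) r' true) ρ false ⟩
  false ∎))
  where open ≡-Reasoning

minimal-exists : ∀ D → ∃ (Min D)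
minimal-exists D with settleRightOf 0 (λ _ → ⊤) (λ _ _ _ _ → tt) D tt
... | E , D↝E , settled , _ = E , D↝E , stuck⇒fixed settled

colSize-count : ∀ E c {n} → bound E < n → colSize E c ≡ count (column E c) n
colSize-count E c {n} bound<n = trans (length-filter-upTo (column E c) (suc (bound E)))
  (sym (sumBelow-vanishing _ bound<n (λ i bound<i → cong (λ b → if b then 1 else 0)
         (¬-not (λ e → <⇒≱ bound<i (∋-row-bound E e))))))

colSize-step : ∀ {D ρ E} → KMove D ρ E → ∀ c → colSize E c ≡ colSize D c
colSize-step {D} {ρ} {E} step c = begin
  colSize E c          ≡⟨ colSize-count E c (s≤s (m≤n⊔m (bound D) (bound E))) ⟩
  count (column E c) n ≡⟨ counts step ⟩
  count (column D c) n ≡⟨ colSize-count D c (s≤s (m≤m⊔n (bound D) (bound E))) ⟨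
  colSize D c          ∎
  where
  open ≡-Reasoning
  n = suc (bound D ⊔ bound E)
  count-cong : ∀ {f g : ℕ → Bool} → (∀ i → f i ≡ g i) → count f n ≡ count g n
  count-cong f≡g = sumBelow-cong n (λ i _ → cong (λ b → if b then 1 else 0) (f≡g i))
  counts : KMove D ρ E → count (column E c) n ≡ count (column D c) n
  counts (empty-row _ D≈E) = count-cong (λ i → sym (D≈E i c))
  counts (stuck _ _ _ D≈E) = count-cong (λ i → sym (D≈E i c))
  counts (move c0 r' (e , _) _ r'<ρ free _ E≡moved) with c ≟ c0
  ... | no c≢c0 = count-cong (λ i → trans (E≡moved i c) (moveCell-elsewhere D ρ r' c0 c≢c0))
  ... | yes refl = +-cancelʳ-≡ 1 _ _ (trans
        (cong (_+ 1) (count-cong (λ i → trans (E≡moved i c) (moveCell-column D ρ r' c i))))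
        (sumWhere-move (column D c) (λ _ → 1) e free r'<ρ (s≤s (≤-trans (∋-row-bound D e) (m≤m⊔n _ _)))))

colSize-KD : ∀ {D E} → KD D E → ∀ c → colSize E c ≡ colSize D c
colSize-KD ε                 c = refl
colSize-KD ((_ , step) ◅ D↝E) c = trans (colSize-KD D↝E c) (colSize-step step c)

KMove-origin : ∀ {D ρ E x y} → KMove D ρ E → E ∋ x , y → ∃[ x0 ] (x ≤ x0 × D ∋ x0 , y)
KMove-origin {x = x} {y} (empty-row _ D≈E) e = x , ≤-refl , trans (D≈E x y) e
KMove-origin {x = x} {y} (stuck _ _ _ D≈E) e = x , ≤-refl , trans (D≈E x y) e
KMove-origin {D} {ρ} {x = x} {y} (move c0 r' (e0 , _) _ r'<ρ _ _ E≡moved) e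
  with moveCell-source D ρ r' c0 {x} {y} (trans (sym (E≡moved x y)) e)
... | inj₁ (refl , refl) = ρ , <⇒≤ r'<ρ , e0
... | inj₂ e'            = x , ≤-refl , e'

KD-origin : ∀ {D E x y} → KD D E → E ∋ x , y → ∃[ x0 ] (x ≤ x0 × D ∋ x0 , y)
KD-origin ε e = _ , ≤-refl , e
KD-origin ((_ , step) ◅ D↝E) e with KD-origin D↝E e
... | x1 , x≤x1 , e1 with KMove-origin step e1
...   | x0 , x1≤x0 , e0 = x0 , ≤-trans x≤x1 x1≤x0 , e0

filled⇒≤colSize : ∀ E {c ρ} → E ∋ ρ , c → FilledBelow E c ρ → ρ ≤ colSize E c
filled⇒≤colSize E {c} {ρ} e filled = begin
  ρ                                  ≤⟨ count-full (column E c) ρ (λ i 1≤i i≤ρ → filled′ i 1≤i (s≤s i≤ρ)) ⟩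
  count (column E c) (suc ρ)         ≤⟨ sumBelow-mono _ (s≤s (∋-row-bound E e)) ⟩
  count (column E c) (suc (bound E)) ≡⟨ colSize-count E c ≤-refl ⟨
  colSize E c                        ∎
  where
  open ≤-Reasoning
  filled′ = FilledBelow-extend {E} {c} filled e

colSize-pos : ∀ E {r c} → E ∋ r , c → 1 ≤ colSize E c
colSize-pos E {r} {c} e = subst (1 ≤_) (sym (colSize-count E c ≤-refl))
  (subst (λ b → (if b then 1 else 0) ≤ count (column E c) (suc (bound E))) e
         (term≤sumBelow _ (s≤s (∋-row-bound E e))))

colSize-witness : ∀ E c {m} → 1 ≤ m → m ≤ colSize E c → ∃[ t ] (m ≤ t × E ∋ t , c)
colSize-witness E c 1≤m m≤colSize =
  count-witness (column E c) (suc (bound E)) (row0 E c) 1≤m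
                (subst (_ ≤_) (colSize-count E c ≤-refl) m≤colSize)

topRow-upper : ∀ D c {ρ} → D ∋ ρ , c → ρ ≤ topRow D c
topRow-upper D c {ρ} e = subst (_≤ topRow D c) (cong (λ b → if b then ρ else 0) e)
  (maximum-upper (∈-map⁺ (λ r → if cell D r c then r else 0) (∈-upTo⁺ (s≤s (∋-row-bound D e)))))

topRow-∋ : ∀ D c {ρ} → D ∋ ρ , c → D ∋ topRow D c , c
topRow-∋ D c {ρ} e = attained (maximum-∈ (map weight (rows D)))
  where
  weight : ℕ → ℕ
  weight r = if cell D r c then r else 0
  top-pos : 1 ≤ topRow D c
  top-pos = ≤-trans (∋-row-pos D e) (topRow-upper D c e)
  attained : topRow D c ≡ 0 ⊎ topRow D c ∈ map weight (rows D) → D ∋ topRow D c , c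
  attained (inj₁ top≡0) = contradiction (subst (1 ≤_) top≡0 top-pos) λ ()
  attained (inj₂ top∈) with ∈-map⁻ weight top∈
  ... | r , _ , top≡ with cell D r c in er
  ...   | true  = subst (λ x → D ∋ x , c) (sym top≡) er
  ...   | false = contradiction (subst (1 ≤_) top≡ top-pos) λ ()

maxRight-upper : ∀ D c {c' t} → c < c' → D ∋ t , c' → colSize D c' ≤ maxRight D c
maxRight-upper D c c<c' e =
  maximum-upper (∈-map⁺ (colSize D) (∈-drop-upTo⁺ {n = suc (bound D)} c<c' (s≤s (∋-col-bound D e))))

maxRight-attained : ∀ D c → 1 ≤ maxRight D c → ∃[ c' ] (c < c' × colSize D c' ≡ maxRight D c)
maxRight-attained D c M-pos with maximum-∈ (map (colSize D) (drop (suc c) (upTo (suc (bound D)))))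
... | inj₁ M≡0 = contradiction (subst (1 ≤_) M≡0 M-pos) λ ()
... | inj₂ M∈ with ∈-map⁻ (colSize D) M∈
...   | c' , c'∈ , M≡ = c' , ∈-drop-upTo⁻ {n = suc (bound D)} c'∈ , sym M≡

h-spec : ∀ D c → (topRow D c ≤ maxRight D c × h D c ≡ topRow D c)
               ⊎ (maxRight D c < topRow D c × maxRight D c ≤ colSize D c × h D c ≡ colSize D c)
               ⊎ (maxRight D c < topRow D c × colSize D c < maxRight D c × h D c ≡ maxRight D c)
h-spec D c with topRow D c ≤? maxRight D c
... | yes r≤M = inj₁ (r≤M , refl)
... | no r≰M with maxRight D c ≤? colSize D c
...   | yes M≤m = inj₂ (inj₁ (≰⇒> r≰M , M≤m , refl))
...   | no M≰m  = inj₂ (inj₂ (≰⇒> r≰M , ≰⇒> M≰m , refl))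

h-upper : ∀ D c {ρ} → ρ ≤ topRow D c → ρ ≤ colSize D c ⊎ ρ ≤ maxRight D c → ρ ≤ h D c
h-upper D c ρ≤r ρ≤m⊎M with h-spec D c | ρ≤m⊎M
... | inj₁ (_ , h≡r)                | _        rewrite h≡r = ρ≤r
... | inj₂ (inj₁ (_ , M≤m , h≡m)) | inj₁ ρ≤m rewrite h≡m = ρ≤m
... | inj₂ (inj₁ (_ , M≤m , h≡m)) | inj₂ ρ≤M rewrite h≡m = ≤-trans ρ≤M M≤m
... | inj₂ (inj₂ (_ , m<M , h≡M)) | inj₁ ρ≤m rewrite h≡M = ≤-trans ρ≤m (<⇒≤ m<M)
... | inj₂ (inj₂ (_ , m<M , h≡M)) | inj₂ ρ≤M rewrite h≡M = ρ≤M

Min⇒row≤h : ∀ D c {E ρ} → Min D E → E ∋ ρ , c → ρ ≤ h D c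
Min⇒row≤h D c {E} {ρ} (D↝E , fixed) e with fixed⇒filled fixed e
... | c0 , rm@(e0 , _) , filled = h-upper D c below-top beside
  where
  ρ≤colSize : ρ ≤ colSize D c0
  ρ≤colSize = subst (ρ ≤_) (colSize-KD D↝E c0) (filled⇒≤colSize E e0 filled)
  below-top : ρ ≤ topRow D c
  below-top with KD-origin D↝E e
  ... | _ , ρ≤x0 , d = ≤-trans ρ≤x0 (topRow-upper D c d)
  beside : ρ ≤ colSize D c ⊎ ρ ≤ maxRight D c
  beside with m≤n⇒m<n∨m≡n (rightmost-≥ {E} {ρ} rm e)
  ... | inj₂ refl = inj₁ ρ≤colSize
  ... | inj₁ c<c0 with KD-origin D↝E e0
  ...   | _ , _ , d0 = inj₂ (≤-trans ρ≤colSize (maxRight-upper D c c<c0 d0))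

KMove-elsewhere : ∀ {E ρ E' c0 x y} → KMove E ρ E' → Rightmost E ρ c0 → y ≢ c0 →
                  cell E' x y ≡ cell E x y
KMove-elsewhere {x = x} {y} (empty-row _ E≈E') _ _ = sym (E≈E' x y)
KMove-elsewhere {x = x} {y} (stuck _ _ _ E≈E') _ _ = sym (E≈E' x y)
KMove-elsewhere {E} {ρ} {x = x} {y} (move c1 r' rm1 _ _ _ _ E≡moved) rm y≢c0 =
  trans (E≡moved x y) (moveCell-elsewhere E ρ r' c1 (subst (y ≢_) (rightmost-unique {E} {ρ} rm rm1) y≢c0))

moveCell-keeps : ∀ E ρ r' c {x} → x ≢ ρ → E ∋ x , c → moveCell E ρ r' c x c ≡ true
moveCell-keeps E ρ r' c {x} x≢ρ e =
  trans (moveCell-column E ρ r' c x)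
        (trans (set-≢ (set (column E c) r' true) false x≢ρ) (set-true (column E c) r' e))

moveCell-lands : ∀ E ρ r' c → r' ≢ ρ → moveCell E ρ r' c r' c ≡ true
moveCell-lands E ρ r' c r'≢ρ =
  trans (moveCell-column E ρ r' c r')
        (trans (set-≢ (set (column E c) r' true) false r'≢ρ) (set-≡ (column E c) r' true))

ReachesRow : Diagram → ℕ → ℕ → Set
ReachesRow E c T = ∃[ ρ ] (T ≤ ρ × E ∋ ρ , c)

-- A cell leaving a row above T either lands in a row ≥ T or jumps over row T, which the
-- move only does when (T, c) is occupied.
ReachesRow-move : ∀ {E E' c ρ r' T} → (∀ x → cell E' x c ≡ moveCell E ρ r' c x c) →
                  (∀ r → r' < r → r < ρ → E ∋ r , c) → r' < ρ → T < ρ →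
                  ReachesRow E c T → ReachesRow E' c T
ReachesRow-move {E} {E'} {c} {ρ} {r'} {T} E≡moved gap r'<ρ T<ρ (ρ0 , T≤ρ0 , e) with ρ0 ≟ ρ | T ≤? r'
... | no ρ0≢ρ | _        = ρ0 , T≤ρ0 , trans (E≡moved ρ0) (moveCell-keeps E ρ r' c ρ0≢ρ e)
... | yes _   | yes T≤r' = r' , T≤r' , trans (E≡moved r') (moveCell-lands E ρ r' c (<⇒≢ r'<ρ))
... | yes _   | no T≰r'  =
  T , ≤-refl , trans (E≡moved T) (moveCell-keeps E ρ r' c (<⇒≢ T<ρ) (gap T (≰⇒> T≰r') T<ρ))

record Anchored (c T : ℕ) (E : Diagram) : Set where
  field
    stuckRight : StuckRightOf c E
    support    : ∃[ c1 ] (c < c1 × FilledBelow E c1 (suc T))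
    high       : ReachesRow E c T
open Anchored

-- Rows 1 … T all contain a cell right of c, so their rightmost cell is not in column c.
Anchored-row-above : ∀ {c T E ρ} → Anchored c T E → Rightmost E ρ c → T < ρ
Anchored-row-above {c} {T} {E} {ρ} a (e , right) with T <? ρ | support a
... | yes T<ρ | _ = T<ρ
... | no T≮ρ | c1 , c<c1 , filled =
  contradiction (filled ρ (∋-row-pos E e) (s≤s (≮⇒≥ T≮ρ))) (not-¬ (right c1 c<c1))

Anchored-transfer : ∀ {c T E E'} → (∀ x y → c < y → cell E' x y ≡ cell E x y) →
                    Anchored c T E → ReachesRow E' c T → Anchored c T E'
Anchored-transfer {c} {T} {E} {E'} same a high' = record
  { stuckRight = λ ρ c0 rm c<c0 r 1≤r r<ρ →
      trans (same r c0 c<c0) (stuckRight a ρ c0 (rightmost′ c<c0 rm) c<c0 r 1≤r r<ρ)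
  ; support    = support′ (support a)
  ; high       = high'
  }
  where
  rightmost′ : ∀ {ρ c0} → c < c0 → Rightmost E' ρ c0 → Rightmost E ρ c0
  rightmost′ {ρ} {c0} c<c0 (e , right) =
    trans (sym (same ρ c0 c<c0)) e , λ c' c0<c' → trans (sym (same ρ c' (<-trans c<c0 c0<c'))) (right c' c0<c')
  support′ : ∃[ c1 ] (c < c1 × FilledBelow E c1 (suc T)) → ∃[ c1 ] (c < c1 × FilledBelow E' c1 (suc T))
  support′ (c1 , c<c1 , filled) = c1 , c<c1 , λ r 1≤r r≤T → trans (same r c1 c<c1) (filled r 1≤r r≤T)

ReachesRow-agree : ∀ {E E' c T} → (∀ x → cell E' x c ≡ cell E x c) → ReachesRow E c T → ReachesRow E' c T
ReachesRow-agree same (ρ , T≤ρ , e) = ρ , T≤ρ , trans (same ρ) e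

Anchored-≈ : ∀ {c T E E'} → E ≈D E' → Anchored c T E → Anchored c T E'
Anchored-≈ {c} {T} {E} {E'} E≈E' a =
  Anchored-transfer (λ x y _ → sym (E≈E' x y)) a (ReachesRow-agree {E} {E'} (λ x → sym (E≈E' x c)) (high a))

Anchored-move : ∀ {c T E ρ E'} → KMove E ρ E' → Anchored c T E → Anchored c T E'
Anchored-move (empty-row _ E≈E') = Anchored-≈ E≈E'
Anchored-move (stuck _ _ _ E≈E') = Anchored-≈ E≈E'
Anchored-move {c} {E = E} {ρ} {E'} step@(move c1 r' rm 1≤r' r'<ρ free gap E≡moved) a with <-cmp c1 c
... | tri> _ _ c<c1 = contradiction (stuckRight a ρ c1 rm c<c1 r' 1≤r' r'<ρ) (not-¬ free)
... | tri< c1<c _ _ = Anchored-transfer (λ _ _ c<y → KMove-elsewhere step rm (>⇒≢ (<-trans c1<c c<y))) a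
      (ReachesRow-agree {E} {E'} (λ _ → KMove-elsewhere step rm (>⇒≢ c1<c)) (high a))
... | tri≈ _ refl _ = Anchored-transfer (λ _ _ c<y → KMove-elsewhere step rm (>⇒≢ c<y)) a
      (ReachesRow-move {E} {E'} {c} {ρ} {r'} (λ x → E≡moved x c) gap r'<ρ (Anchored-row-above a rm) (high a))

-- The column c' realising M has a cell in some row t ≥ M, and row t is stuck once everything
-- right of c is settled.
Anchored-start : ∀ D c {T r} → D ∋ r , c → T ≤ r → 1 ≤ maxRight D c → T ≤ maxRight D c →
                 ∃[ E ] (KD D E × Anchored c T E)
Anchored-start D c {T} {r} e T≤r M-pos T≤M
  with settleRightOf c (λ E → E ∋ r , c) (λ rm c<c0 step → trans (KMove-elsewhere step rm (<⇒≢ c<c0))) D e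
... | E , D↝E , settled , e' with maxRight-attained D c M-pos
...   | c' , c<c' , colSize≡M
  with colSize-witness E c' M-pos (≤-reflexive (sym (trans (colSize-KD D↝E c') colSize≡M)))
...     | t , M≤t , et with rightmost? E t
...       | inj₁ empty     = contradiction et (not-¬ (empty c'))
...       | inj₂ (c1 , rm) = E , D↝E , record
  { stuckRight = settled
  ; support    = c1 , c<c1 , FilledBelow-mono {E} {c1} (s≤s (≤-trans T≤M M≤t))
                               (FilledBelow-extend {E} {c1} (settled t c1 rm c<c1) (proj₁ rm))
  ; high       = r , T≤r , e'
  }
  where
  c<c1 : c < c1
  c<c1 = <-≤-trans c<c' (rightmost-≥ {E} {t} rm et)

Min-reaching : ∀ D c {T r} → D ∋ r , c → T ≤ r → 1 ≤ maxRight D c → T ≤ maxRight D c →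
               ∃[ E ] (Min D E × ReachesRow E c T)
Min-reaching D c {T} e T≤r M-pos T≤M with Anchored-start D c e T≤r M-pos T≤M
... | E , D↝E , a with settleRightOf 0 (Anchored c T) (λ _ _ step → Anchored-move step) E a
...   | E' , E↝E' , settled , a' = E' , (D↝E ◅◅ E↝E' , stuck⇒fixed settled) , high a'

Min-reaching-h : ∀ D c {r} → D ∋ r , c → ∃[ E ] (Min D E × ReachesRow E c (h D c))
Min-reaching-h D c e with h-spec D c | topRow-∋ D c e
... | inj₁ (r≤M , h≡r) | top rewrite h≡r =
  Min-reaching D c top ≤-refl (≤-trans (∋-row-pos D top) r≤M) r≤M
... | inj₂ (inj₂ (M<r , m<M , h≡M)) | top rewrite h≡M =
  Min-reaching D c top (<⇒≤ M<r) (≤-trans (s≤s z≤n) m<M) ≤-refl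
... | inj₂ (inj₁ (_ , _ , h≡m)) | _ rewrite h≡m with minimal-exists D
...   | E , min@(D↝E , _) = E , min ,
  colSize-witness E c (colSize-pos D e) (≤-reflexive (sym (colSize-KD D↝E c)))

proposition4p5 : (D : Diagram) (c : ℕ) → (∃[ r ] (D ∋ r , c))
    → (∃[ E ] (Min D E × (E ∋ h D c , c)))
      × (∀ E r → Min D E → E ∋ r , c → r ≤ h D c)
proposition4p5 D c (_ , e) = attained , λ E r min e' → Min⇒row≤h D c min e'
  where
  attained : ∃[ E ] (Min D E × (E ∋ h D c , c))
  attained with Min-reaching-h D c e
  ... | E , min , ρ , h≤ρ , eρ =
    E , min , subst (λ x → E ∋ x , c) (≤-antisym (Min⇒row≤h D c min eρ) h≤ρ) eρ
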